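{- Let $k,r,n$ be positive integers with $r\le\lceil k/2\rceil$ and $k\le n$. Let $D$ be a digraph of order $n$ with $a(D)>(k-1)n$. Then $D$ has a subdigraph $D'$ such that (1) $a(D')>(k-1)(|(D')^+|+|(D')^-|)/2$; (2) $\deg^+_{D'}(a)+\deg^-_{D'}(b)\ge k$ for all $a\in(D')^+$ and $b\in(D')^-$; and additionally one of the following holds: (3-I) $\overline{\delta^+}(D')\ge k/2$, $\overline{\delta^- }(D')\ge r$, there is $a\in V(D')$ with $\deg^+_{D'}(a)\ge k$, and $|(D')^+|\le|(D')^-|$; or (3-II) $\overline{\delta^0}(D')\ge k/2$, there is $b\in V(D')$ with $\deg^-_{D'}(b)\ge k$, and $\deg^+_D(a)>k-r$ for every $a\in(D')^+$.
   Context: A digraph is finite, without loops or parallel arcs, but may contain both $xy$ and $yx$; $a(D)$ is its number of arcs. $D^+$ ($D^-$) is the set of vertices with positive out-degree (in-degree). The minimum pseudo-out-degree $\overline{\delta^+}(D)$ is $0$ if $D$ has no arcs, and otherwise the largest $d\in\mathbb N$ such that every vertex $a$ has $\deg^+(a)=0$ or $\deg^+(a)\ge d$; $\overline{\delta^- }(D)$ is defined analogously with in-degrees, and $\overline{\delta^0}(D)=\min\{\overline{\delta^+}(D),\overline{\delta^- }(D)\}$ (minimum pseudo-semidegree). -}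

module Defs where

open import Data.Nat using (ℕ; zero; suc; _+_; _*_; _≤_; _<_; _⊓_)
open import Data.Fin using (Fin; zero; suc)
open import Data.Bool using (Bool; true; false; if_then_else_)
open import Data.Product using (_×_; Σ; ∃)
open import Data.Sum using (_⊎_)
open import Relation.Binary.PropositionalEquality using (_≡_)

-- A digraph on vertex set Fin n, given by its arc-indicator: D x y ≡ true iff xy is an arc.
-- Parallel arcs are impossible by construction; both xy and yx may be present.
Digraph : ℕ → Set
Digraph n = Fin n → Fin n → Bool

Loopless : ∀ {n} → Digraph n → Set
Loopless {n} D = ∀ (x : Fin n) → D x x ≡ false

count : ∀ {n} → (Fin n → Bool) → ℕ
count {zero}  P = 0
count {suc n} P = (if P zero then 1 else 0) + count (λ i → P (suc i))

outdeg : ∀ {n} → Digraph n → Fin n → ℕ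
outdeg D a = count (λ b → D a b)

indeg : ∀ {n} → Digraph n → Fin n → ℕ
indeg D b = count (λ a → D a b)

sumF : ∀ {n} → (Fin n → ℕ) → ℕ
sumF {zero}  f = 0
sumF {suc n} f = f zero + sumF (λ i → f (suc i))

arcs : ∀ {n} → Digraph n → ℕ
arcs D = sumF (outdeg D)

isPos : ℕ → Bool
isPos zero    = false
isPos (suc _) = true

plusSize : ∀ {n} → Digraph n → ℕ
plusSize D = count (λ a → isPos (outdeg D a))

minusSize : ∀ {n} → Digraph n → ℕ
minusSize D = count (λ b → isPos (indeg D b))

InPlus : ∀ {n} → Digraph n → Fin n → Set
InPlus D a = 0 < outdeg D a

InMinus : ∀ {n} → Digraph n → Fin n → Set
InMinus D b = 0 < indeg D b

_⊑_ : ∀ {n} → Digraph n → Digraph n → Set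
_⊑_ {n} D' D = ∀ (x y : Fin n) → D' x y ≡ true → D x y ≡ true

PseudoBound : ∀ {n} → (Fin n → ℕ) → ℕ → Set
PseudoBound {n} deg d = ∀ (a : Fin n) → deg a ≡ 0 ⊎ d ≤ deg a

IsMinPseudo : ∀ {n} → Digraph n → (Fin n → ℕ) → ℕ → Set
IsMinPseudo D deg d =
  (arcs D ≡ 0 × d ≡ 0) ⊎
  (0 < arcs D × PseudoBound deg d × (∀ d' → PseudoBound deg d' → d' ≤ d))

IsMinPseudoOut : ∀ {n} → Digraph n → ℕ → Set
IsMinPseudoOut D = IsMinPseudo D (outdeg D)

IsMinPseudoIn : ∀ {n} → Digraph n → ℕ → Set
IsMinPseudoIn D = IsMinPseudo D (indeg D)

IsMinPseudoSemi : ∀ {n} → Digraph n → ℕ → Set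
IsMinPseudoSemi D d = Σ ℕ λ dp → Σ ℕ λ dm →
  IsMinPseudoOut D dp × IsMinPseudoIn D dm × d ≡ dp ⊓ dm

-- Write k = A + 1, r = R + 1 and Q = A ∸ R, so that R ≤ Q and Q + R = A. Starting from D,
-- repeatedly delete all arcs leaving a vertex a ∈ D⁺, or entering a vertex b ∈ D⁻, or both,
-- whenever 2d⁺(a) ≤ A, d⁻(b) ≤ R, d⁺(a) + d⁻(b) ≤ A, or |D⁺| > |D⁻| and d⁺(a) ≤ Q.
-- Every deletion preserves A(|D⁺| + |D⁻|) < 2a(D) and Q|D⁺| + R|D⁻| < a(D), both implied by
-- a(D) > An; after a deletion of the last kind |D⁻| ≤ |D⁺|, and then the first invariant follows
-- from the second by Chebyshev's sum inequality. If the process stops with |D⁺| ≤ |D⁻| we are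
-- in case (3-I). Otherwise a second round, with the in-degree condition replaced by
-- 2d⁻(b) ≤ A and only the first invariant kept, stops in (3-I) or (3-II), and the bound
-- d⁺_D(a) > Q of (3-II) is inherited from the first round. The vertex of degree ≥ k also
-- comes from the first invariant: if all out-degrees were ≤ A, then 2a ≤ 2A|D⁺| ≤ A(|D⁺| + |D⁻|).

{-# OPTIONS --safe #-}
module Submission where

open import Defs
open import Data.Bool using (Bool; true; false; if_then_else_)
open import Data.Fin using (Fin; zero; suc; _≟_)
open import Data.Fin.Properties using (any?; suc-injective)
open import Data.Nat using (ℕ; zero; suc; _+_; _*_; _≤_; _<_; _∸_; _⊓_; z≤n; s≤s; s≤s⁻¹; z<s; _≤?_; _<?_)
open import Data.Nat.Induction using (<-wellFounded)
open import Data.Nat.Properties hiding (_≟_; suc-injective)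
open import Algebra.Properties.CommutativeMonoid.Sum +-0-commutativeMonoid using (sum; sum-cong-≗; ∑-comm)
open import Algebra.Properties.CommutativeSemigroup +-commutativeSemigroup using (xy∙z≈zy∙x)
open import Data.Nat.Solver using (module +-*-Solver)
open import Data.Product using (_×_; Σ; ∃; ∃₂; _,_; proj₂)
open import Data.Sum using (_⊎_; inj₁; inj₂; [_,_]′)
open import Function using (_∘_; id)
open import Induction.WellFounded using (Acc; acc)
open import Relation.Nullary using (yes; no; contradiction)
open import Relation.Nullary.Decidable using (_×-dec_)
open import Relation.Binary.PropositionalEquality

sumF-cong : ∀ {n} {f g : Fin n → ℕ} → (∀ i → f i ≡ g i) → sumF f ≡ sumF g
sumF-cong {zero}  f≗g = refl
sumF-cong {suc n} f≗g = cong₂ _+_ (f≗g zero) (sumF-cong (f≗g ∘ suc))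

sumF≡sum : ∀ {n} (f : Fin n → ℕ) → sumF f ≡ sum f
sumF≡sum {zero}  f = refl
sumF≡sum {suc n} f = cong (f zero +_) (sumF≡sum (f ∘ suc))

indicator : Bool → ℕ
indicator b = if b then 1 else 0

count≡sumF : ∀ {n} (P : Fin n → Bool) → count P ≡ sumF (indicator ∘ P)
count≡sumF {zero}  P = refl
count≡sumF {suc n} P = cong (indicator (P zero) +_) (count≡sumF (P ∘ suc))

sumF-update : ∀ {n} (f g : Fin n → ℕ) (a : Fin n) →
  (∀ x → x ≢ a → f x ≡ g x) → sumF f + g a ≡ sumF g + f a
sumF-update {suc n} f g zero agree = begin
  f zero + sumF (f ∘ suc) + g zero  ≡⟨ cong (λ s → f zero + s + g zero) (sumF-cong (λ x → agree (suc x) λ ())) ⟩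
  f zero + sumF (g ∘ suc) + g zero  ≡⟨ xy∙z≈zy∙x (f zero) _ (g zero) ⟩
  g zero + sumF (g ∘ suc) + f zero  ∎
  where open ≡-Reasoning
sumF-update {suc n} f g (suc a) agree = begin
  f zero + sumF (f ∘ suc) + g (suc a)    ≡⟨ +-assoc (f zero) _ _ ⟩
  f zero + (sumF (f ∘ suc) + g (suc a))  ≡⟨ cong₂ _+_ (agree zero λ ()) (sumF-update (f ∘ suc) (g ∘ suc) a agree′) ⟩
  g zero + (sumF (g ∘ suc) + f (suc a))  ≡⟨ +-assoc (g zero) _ _ ⟨
  g zero + sumF (g ∘ suc) + f (suc a)    ∎
  where
  open ≡-Reasoning
  agree′ : ∀ x → x ≢ a → f (suc x) ≡ g (suc x)
  agree′ x x≢a = agree (suc x) (x≢a ∘ suc-injective)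

sumF-positive : ∀ {n} (f : Fin n → ℕ) → 0 < sumF f → ∃ λ i → 0 < f i
sumF-positive {suc n} f pos with f zero in eq
... | suc _ = zero , subst (0 <_) (sym eq) z<s
... | zero with sumF-positive (f ∘ suc) pos
...   | i , fi>0 = suc i , fi>0

sumF≤*count : ∀ {n} (f : Fin n → ℕ) {c} → (∀ i → f i ≤ c) → sumF f ≤ c * count (isPos ∘ f)
sumF≤*count {zero}  f f≤c = z≤n
sumF≤*count {suc n} f {c} f≤c with f zero in eq
... | zero  = sumF≤*count (f ∘ suc) (f≤c ∘ suc)
... | suc m = subst (suc m + sumF (f ∘ suc) ≤_) (sym (*-suc c _))
                (+-mono-≤ (subst (_≤ c) eq (f≤c zero)) (sumF≤*count (f ∘ suc) (f≤c ∘ suc)))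

count-mono : ∀ {n} {P Q : Fin n → Bool} → (∀ i → P i ≡ true → Q i ≡ true) → count P ≤ count Q
count-mono {zero}          P⇒Q = z≤n
count-mono {suc n} {P} {Q} P⇒Q with P zero in p0 | Q zero in q0
... | true  | true  = s≤s (count-mono (P⇒Q ∘ suc))
... | true  | false = contradiction (trans (sym q0) (P⇒Q zero p0)) λ ()
... | false | true  = m≤n⇒m≤1+n (count-mono (P⇒Q ∘ suc))
... | false | false = count-mono (P⇒Q ∘ suc)

count-cong : ∀ {n} {P Q : Fin n → Bool} → (∀ i → P i ≡ Q i) → count P ≡ count Q
count-cong P≗Q = ≤-antisym (count-mono λ i → trans (sym (P≗Q i))) (count-mono λ i → trans (P≗Q i))

count-false : ∀ {n} {P : Fin n → Bool} → (∀ i → P i ≡ false) → count P ≡ 0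
count-false {zero}  P≗false = refl
count-false {suc n} P≗false rewrite P≗false zero = count-false (P≗false ∘ suc)

count≤n : ∀ {n} (P : Fin n → Bool) → count P ≤ n
count≤n {zero}  P = z≤n
count≤n {suc n} P with P zero
... | true  = s≤s (count≤n (P ∘ suc))
... | false = m≤n⇒m≤1+n (count≤n (P ∘ suc))

count-update : ∀ {n} {P Q : Fin n → Bool} (a : Fin n) → (∀ x → x ≢ a → P x ≡ Q x) →
  P a ≡ true → Q a ≡ false → count P ≡ suc (count Q)
count-update {P = P} {Q} a agree Pa Qa = begin
  count P                                 ≡⟨ +-identityʳ (count P) ⟨
  count P + indicator false               ≡⟨ cong₂ (λ s b → s + indicator b) (count≡sumF P) (sym Qa) ⟩
  sumF (indicator ∘ P) + indicator (Q a)  ≡⟨ sumF-update _ _ a (λ x x≢a → cong indicator (agree x x≢a)) ⟩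
  sumF (indicator ∘ Q) + indicator (P a)  ≡⟨ cong₂ (λ s b → s + indicator b) (sym (count≡sumF Q)) Pa ⟩
  count Q + 1                             ≡⟨ +-comm (count Q) 1 ⟩
  suc (count Q)                           ∎
  where open ≡-Reasoning

-- indeg E and minusSize E are definitionally outdeg (E ᵀ) and plusSize (E ᵀ); this is how
-- every statement about in-degrees below is obtained from its out-degree counterpart.
infixl 30 _ᵀ

_ᵀ : ∀ {n} → Digraph n → Digraph n
(E ᵀ) x y = E y x

arcs≡∑∑ : ∀ {n} (E : Digraph n) → arcs E ≡ sum (λ a → sum (λ b → indicator (E a b)))
arcs≡∑∑ E = trans (sumF≡sum (outdeg E)) (sum-cong-≗ (λ a → trans (count≡sumF (E a)) (sumF≡sum (indicator ∘ E a))))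

arcs-ᵀ : ∀ {n} (E : Digraph n) → arcs (E ᵀ) ≡ arcs E
arcs-ᵀ E = trans (arcs≡∑∑ (E ᵀ)) (trans (∑-comm (λ b a → indicator (E a b))) (sym (arcs≡∑∑ E)))

⊑-refl : ∀ {n} {E : Digraph n} → E ⊑ E
⊑-refl x y Exy = Exy

⊑-trans : ∀ {n} {E₁ E₂ E₃ : Digraph n} → E₁ ⊑ E₂ → E₂ ⊑ E₃ → E₁ ⊑ E₃
⊑-trans E₁⊑E₂ E₂⊑E₃ x y = E₂⊑E₃ x y ∘ E₁⊑E₂ x y

⊑-ᵀ : ∀ {n} {E′ E : Digraph n} → E′ ⊑ E → E′ ᵀ ⊑ E ᵀ
⊑-ᵀ E′⊑E x y = E′⊑E y x

outdeg-mono : ∀ {n} {E′ E : Digraph n} → E′ ⊑ E → ∀ a → outdeg E′ a ≤ outdeg E a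
outdeg-mono E′⊑E a = count-mono (E′⊑E a)

isPos-mono : ∀ {m n} → m ≤ n → isPos m ≡ true → isPos n ≡ true
isPos-mono {suc m} (s≤s _) _ = refl

isPos-positive : ∀ {m} → 0 < m → isPos m ≡ true
isPos-positive (s≤s _) = refl

plusSize-mono : ∀ {n} {E′ E : Digraph n} → E′ ⊑ E → plusSize E′ ≤ plusSize E
plusSize-mono E′⊑E = count-mono (λ a → isPos-mono (outdeg-mono E′⊑E a))

minusSize-mono : ∀ {n} {E′ E : Digraph n} → E′ ⊑ E → minusSize E′ ≤ minusSize E
minusSize-mono E′⊑E = plusSize-mono (⊑-ᵀ E′⊑E)

source-exists : ∀ {n} (E : Digraph n) → 0 < arcs E → ∃ λ a → 0 < outdeg E a
source-exists E = sumF-positive (outdeg E)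

sink-exists : ∀ {n} (E : Digraph n) → 0 < arcs E → ∃ λ b → 0 < indeg E b
sink-exists E arcs>0 = source-exists (E ᵀ) (subst (0 <_) (sym (arcs-ᵀ E)) arcs>0)

deleteOut : ∀ {n} → Fin n → Digraph n → Digraph n
deleteOut a E x y with x ≟ a
... | yes _ = false
... | no  _ = E x y

deleteIn : ∀ {n} → Fin n → Digraph n → Digraph n
deleteIn b E = deleteOut b (E ᵀ) ᵀ

deletePair : ∀ {n} → Fin n → Fin n → Digraph n → Digraph n
deletePair a b E = deleteIn b (deleteOut a E)

deleteOut-self : ∀ {n} (a : Fin n) (E : Digraph n) y → deleteOut a E a y ≡ false
deleteOut-self a E y with a ≟ a
... | yes _   = refl
... | no  a≢a = contradiction refl a≢a

deleteOut-other : ∀ {n} {a x : Fin n} (E : Digraph n) y → x ≢ a → deleteOut a E x y ≡ E x y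
deleteOut-other {a = a} {x} E y x≢a with x ≟ a
... | yes x≡a = contradiction x≡a x≢a
... | no  _   = refl

deleteOut-mono : ∀ {n} (a : Fin n) {E′ E : Digraph n} → E′ ⊑ E → deleteOut a E′ ⊑ deleteOut a E
deleteOut-mono a E′⊑E x y with x ≟ a
... | yes _ = id
... | no  _ = E′⊑E x y

deleteOut-⊑ : ∀ {n} (a : Fin n) (E : Digraph n) → deleteOut a E ⊑ E
deleteOut-⊑ a E x y with x ≟ a
... | yes _ = λ ()
... | no  _ = id

deleteIn-⊑ : ∀ {n} (b : Fin n) (E : Digraph n) → deleteIn b E ⊑ E
deleteIn-⊑ b E = ⊑-ᵀ (deleteOut-⊑ b (E ᵀ))

outdeg-deleteOut-self : ∀ {n} (a : Fin n) (E : Digraph n) → outdeg (deleteOut a E) a ≡ 0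
outdeg-deleteOut-self a E = count-false (deleteOut-self a E)

arcs-deleteOut : ∀ {n} (a : Fin n) (E : Digraph n) → arcs E ≡ arcs (deleteOut a E) + outdeg E a
arcs-deleteOut a E = begin
  arcs E                             ≡⟨ +-identityʳ (arcs E) ⟨
  arcs E + 0                         ≡⟨ cong (arcs E +_) (outdeg-deleteOut-self a E) ⟨
  arcs E + outdeg (deleteOut a E) a  ≡⟨ sumF-update _ _ a outdeg-agree ⟩
  arcs (deleteOut a E) + outdeg E a  ∎
  where
  open ≡-Reasoning
  outdeg-agree : ∀ x → x ≢ a → outdeg E x ≡ outdeg (deleteOut a E) x
  outdeg-agree x x≢a = count-cong (λ y → sym (deleteOut-other E y x≢a))

plusSize-deleteOut : ∀ {n} (a : Fin n) (E : Digraph n) → 0 < outdeg E a →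
  plusSize E ≡ suc (plusSize (deleteOut a E))
plusSize-deleteOut a E outdeg>0 = count-update a isPos-agree
  (isPos-positive outdeg>0) (cong isPos (outdeg-deleteOut-self a E))
  where
  isPos-agree : ∀ x → x ≢ a → isPos (outdeg E x) ≡ isPos (outdeg (deleteOut a E) x)
  isPos-agree x x≢a = cong isPos (count-cong (λ y → sym (deleteOut-other E y x≢a)))

arcs-deleteIn : ∀ {n} (b : Fin n) (E : Digraph n) → arcs E ≡ arcs (deleteIn b E) + indeg E b
arcs-deleteIn b E = begin
  arcs E                                ≡⟨ arcs-ᵀ E ⟨
  arcs (E ᵀ)                            ≡⟨ arcs-deleteOut b (E ᵀ) ⟩
  arcs (deleteOut b (E ᵀ)) + indeg E b  ≡⟨ cong (_+ indeg E b) (arcs-ᵀ (deleteIn b E)) ⟩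
  arcs (deleteIn b E) + indeg E b       ∎
  where open ≡-Reasoning

minusSize-deleteIn : ∀ {n} (b : Fin n) (E : Digraph n) → 0 < indeg E b →
  minusSize E ≡ suc (minusSize (deleteIn b E))
minusSize-deleteIn b E = plusSize-deleteOut b (E ᵀ)

infix 4 _⊏_

_⊏_ : ∀ {n} → Digraph n → Digraph n → Set
E′ ⊏ E = E′ ⊑ E × arcs E′ < arcs E

⊏-of-removal : ∀ {n} {E′ E : Digraph n} {s} → E′ ⊑ E → 0 < s → arcs E ≡ arcs E′ + s → E′ ⊏ E
⊏-of-removal {E′ = E′} {s = s} E′⊑E s>0 arcs≡ =
  E′⊑E , subst (arcs E′ <_) (sym arcs≡) (subst (_≤ arcs E′ + s) (+-comm (arcs E′) 1) (+-monoʳ-≤ (arcs E′) s>0))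

deleteOut-⊏ : ∀ {n} {a : Fin n} {E : Digraph n} → 0 < outdeg E a → deleteOut a E ⊏ E
deleteOut-⊏ {a = a} {E} outdeg>0 = ⊏-of-removal (deleteOut-⊑ a E) outdeg>0 (arcs-deleteOut a E)

deleteIn-⊏ : ∀ {n} {b : Fin n} {E : Digraph n} → 0 < indeg E b → deleteIn b E ⊏ E
deleteIn-⊏ {b = b} {E} indeg>0 = ⊏-of-removal (deleteIn-⊑ b E) indeg>0 (arcs-deleteIn b E)

deletePair-⊏ : ∀ {n} {a b : Fin n} {E : Digraph n} → 0 < outdeg E a → deletePair a b E ⊏ E
deletePair-⊏ {a = a} {b} {E} outdeg>0 =
  ⊑-trans (deleteIn-⊑ b _) (deleteOut-⊑ a E) , ≤-<-trans arcs₂≤arcs₁ (proj₂ (deleteOut-⊏ {E = E} outdeg>0))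
  where
  arcs₂≤arcs₁ : arcs (deletePair a b E) ≤ arcs (deleteOut a E)
  arcs₂≤arcs₁ = subst (arcs (deletePair a b E) ≤_) (sym (arcs-deleteIn b (deleteOut a E))) (m≤m+n _ _)

record ArcsExceed {n} (α β c : ℕ) (E : Digraph n) : Set where
  constructor arcs-exceed
  field
    weight<arcs : α * plusSize E + β * minusSize E < c * arcs E

ArcsExceed-ᵀ : ∀ {n} {α β c} {E : Digraph n} → ArcsExceed α β c E → ArcsExceed β α c (E ᵀ)
ArcsExceed-ᵀ {α = α} {c = c} {E} (arcs-exceed exceed) =
  arcs-exceed (subst₂ _<_ (+-comm (α * plusSize E) _) (cong (c *_) (sym (arcs-ᵀ E))) exceed)

ArcsExceed-arcs>0 : ∀ {n} {α β c} {E : Digraph n} → ArcsExceed α β c E → 0 < arcs E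
ArcsExceed-arcs>0 {c = c} {E} (arcs-exceed exceed) =
  *-cancelˡ-< c 0 (arcs E) (subst (_< c * arcs E) (sym (*-zeroʳ c)) (≤-<-trans z≤n exceed))

ArcsExceed-shrink : ∀ {n} {α β c dp dm s} {E E′ : Digraph n} →
  plusSize E′ + dp ≤ plusSize E → minusSize E′ + dm ≤ minusSize E → arcs E ≤ arcs E′ + s →
  c * s ≤ α * dp + β * dm → ArcsExceed α β c E → ArcsExceed α β c E′
ArcsExceed-shrink {α = α} {β} {c} {dp} {dm} {s} {E} {E′} plus≤ minus≤ arcs≤ cs≤ (arcs-exceed exceed) =
  arcs-exceed (+-cancelʳ-< (c * s) _ _ (begin-strict
    α * plusSize E′ + β * minusSize E′ + c * s                ≤⟨ +-monoʳ-≤ _ cs≤ ⟩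
    α * plusSize E′ + β * minusSize E′ + (α * dp + β * dm)    ≡⟨ regroup α β (plusSize E′) (minusSize E′) dp dm ⟩
    α * (plusSize E′ + dp) + β * (minusSize E′ + dm)          ≤⟨ +-mono-≤ (*-monoʳ-≤ α plus≤) (*-monoʳ-≤ β minus≤) ⟩
    α * plusSize E + β * minusSize E                          <⟨ exceed ⟩
    c * arcs E                                                ≤⟨ *-monoʳ-≤ c arcs≤ ⟩
    c * (arcs E′ + s)                                         ≡⟨ *-distribˡ-+ c (arcs E′) s ⟩
    c * arcs E′ + c * s                                       ∎))
  where
  open ≤-Reasoning
  open +-*-Solver
  regroup : ∀ α β p m dp dm → α * p + β * m + (α * dp + β * dm) ≡ α * (p + dp) + β * (m + dm)
  regroup = solve 6 (λ α β p m dp dm → α :* p :+ β :* m :+ (α :* dp :+ β :* dm) := α :* (p :+ dp) :+ β :* (m :+ dm)) refl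

ArcsExceed-deleteOut : ∀ {n} {α β c} {a : Fin n} {E : Digraph n} → 0 < outdeg E a →
  c * outdeg E a ≤ α → ArcsExceed α β c E → ArcsExceed α β c (deleteOut a E)
ArcsExceed-deleteOut {α = α} {β} {a = a} {E} outdeg>0 c*outdeg≤α =
  ArcsExceed-shrink {dp = 1} {dm = 0}
    (≤-reflexive (trans (+-comm _ 1) (sym (plusSize-deleteOut a E outdeg>0))))
    (≤-trans (≤-reflexive (+-identityʳ _)) (minusSize-mono (deleteOut-⊑ a E)))
    (≤-reflexive (arcs-deleteOut a E))
    (≤-trans c*outdeg≤α (≤-reflexive (sym (trans (cong₂ _+_ (*-identityʳ α) (*-zeroʳ β)) (+-identityʳ α)))))

ArcsExceed-deleteIn : ∀ {n} {α β c} {b : Fin n} {E : Digraph n} → 0 < indeg E b →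
  c * indeg E b ≤ β → ArcsExceed α β c E → ArcsExceed α β c (deleteIn b E)
ArcsExceed-deleteIn indeg>0 c*indeg≤β =
  ArcsExceed-ᵀ ∘ ArcsExceed-deleteOut indeg>0 c*indeg≤β ∘ ArcsExceed-ᵀ

ArcsExceed-deletePair : ∀ {n} {α β c} {a b : Fin n} {E : Digraph n} → 0 < outdeg E a → 0 < indeg E b →
  c * (outdeg E a + indeg E b) ≤ α + β → ArcsExceed α β c E → ArcsExceed α β c (deletePair a b E)
ArcsExceed-deletePair {α = α} {β} {c} {a} {b} {E} outdeg>0 indeg>0 c*s≤α+β =
  ArcsExceed-shrink {dp = 1} {dm = 1} plus≤ minus≤ arcs≤
    (subst (c * (outdeg E a + indeg E b) ≤_) (cong₂ _+_ (sym (*-identityʳ α)) (sym (*-identityʳ β))) c*s≤α+β)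
  where
  open ≤-Reasoning
  E₁ E₂ : Digraph _
  E₁ = deleteOut a E
  E₂ = deletePair a b E
  plus≤ : plusSize E₂ + 1 ≤ plusSize E
  plus≤ = begin
    plusSize E₂ + 1    ≤⟨ +-monoˡ-≤ 1 (plusSize-mono (deleteIn-⊑ b E₁)) ⟩
    plusSize E₁ + 1    ≡⟨ +-comm (plusSize E₁) 1 ⟩
    suc (plusSize E₁)  ≡⟨ plusSize-deleteOut a E outdeg>0 ⟨
    plusSize E         ∎
  -- b may already have left E₁⁻, so compare E₂ with deleteIn b E rather than with E₁.
  minus≤ : minusSize E₂ + 1 ≤ minusSize E
  minus≤ = begin
    minusSize E₂ + 1                ≤⟨ +-monoˡ-≤ 1 (minusSize-mono (⊑-ᵀ (deleteOut-mono b (⊑-ᵀ (deleteOut-⊑ a E))))) ⟩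
    minusSize (deleteIn b E) + 1    ≡⟨ +-comm (minusSize (deleteIn b E)) 1 ⟩
    suc (minusSize (deleteIn b E))  ≡⟨ minusSize-deleteIn b E indeg>0 ⟨
    minusSize E                     ∎
  arcs≤ : arcs E ≤ arcs E₂ + (outdeg E a + indeg E b)
  arcs≤ = begin
    arcs E                              ≡⟨ arcs-deleteOut a E ⟩
    arcs E₁ + outdeg E a                ≡⟨ cong (_+ outdeg E a) (arcs-deleteIn b E₁) ⟩
    arcs E₂ + indeg E₁ b + outdeg E a   ≤⟨ +-monoˡ-≤ (outdeg E a) (+-monoʳ-≤ (arcs E₂) (outdeg-mono (⊑-ᵀ (deleteOut-⊑ a E)) b)) ⟩
    arcs E₂ + indeg E b + outdeg E a    ≡⟨ +-assoc (arcs E₂) _ _ ⟩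
    arcs E₂ + (indeg E b + outdeg E a)  ≡⟨ cong (arcs E₂ +_) (+-comm (indeg E b) _) ⟩
    arcs E₂ + (outdeg E a + indeg E b)  ∎

heavy-source : ∀ {n} {c} {E : Digraph n} → ArcsExceed c c 2 E → plusSize E ≤ minusSize E →
  ∃ λ a → c < outdeg E a
heavy-source {c = c} {E} (arcs-exceed exceed) p≤m with any? (λ a → c <? outdeg E a)
... | yes heavy = heavy
... | no  none  = contradiction exceed (≤⇒≯ (begin
    2 * arcs E                        ≤⟨ *-monoʳ-≤ 2 (sumF≤*count (outdeg E) λ a → ≮⇒≥ λ c<outdeg → none (a , c<outdeg)) ⟩
    2 * (c * plusSize E)              ≡⟨ cong (c * plusSize E +_) (+-identityʳ _) ⟩
    c * plusSize E + c * plusSize E   ≤⟨ +-monoʳ-≤ (c * plusSize E) (*-monoʳ-≤ c p≤m) ⟩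
    c * plusSize E + c * minusSize E  ∎))
  where open ≤-Reasoning

heavy-sink : ∀ {n} {c} {E : Digraph n} → ArcsExceed c c 2 E → minusSize E ≤ plusSize E →
  ∃ λ b → c < indeg E b
heavy-sink exceed = heavy-source (ArcsExceed-ᵀ exceed)

chebyshev : ∀ {x y u v} → y ≤ x → v ≤ u → (x + y) * (u + v) ≤ 2 * (x * u + y * v)
chebyshev {y = y} {v = v} y≤x v≤u with m≤n⇒∃[o]m+o≡n y≤x | m≤n⇒∃[o]m+o≡n v≤u
... | t , refl | w , refl = ≤-trans (m≤m+n _ (t * w)) (≤-reflexive (expand y t v w))
  where
  open +-*-Solver
  expand : ∀ y t v w → (y + t + y) * (v + w + v) + t * w ≡ 2 * ((y + t) * (v + w) + y * v)
  expand = solve 4 (λ y t v w → (y :+ t :+ y) :* (v :+ w :+ v) :+ t :* w :=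
                                con 2 :* ((y :+ t) :* (v :+ w) :+ y :* v)) refl

descend : ∀ {n} {Inv Done : Digraph n → Set} →
  (∀ E → Inv E → Done E ⊎ ∃ λ E′ → E′ ⊏ E × Inv E′) →
  ∀ E → Inv E → ∃ λ E′ → E′ ⊑ E × Inv E′ × Done E′
descend {Inv = Inv} {Done} step E inv = go E inv (<-wellFounded (arcs E))
  where
  go : ∀ E → Inv E → Acc _<_ (arcs E) → ∃ λ E′ → E′ ⊑ E × Inv E′ × Done E′
  go E inv (acc smaller) with step E inv
  ... | inj₁ done = E , ⊑-refl , inv , done
  ... | inj₂ (E′ , (E′⊑E , fewer) , inv′) with go E′ inv′ (smaller fewer)
  ...   | E″ , E″⊑E′ , inv″ , done = E″ , ⊑-trans E″⊑E′ E′⊑E , inv″ , done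

OnSupport : ∀ {n} → (ℕ → Set) → (Fin n → ℕ) → Set
OnSupport L deg = ∀ a → 0 < deg a → L (deg a)

exceeds-on-support? : ∀ {n} (t : ℕ) (h : ℕ → ℕ) (deg : Fin n → ℕ) →
  OnSupport (λ d → t < h d) deg ⊎ ∃ λ a → 0 < deg a × h (deg a) ≤ t
exceeds-on-support? t h deg with any? (λ a → 0 <? deg a ×-dec h (deg a) ≤? t)
... | yes violation = inj₂ violation
... | no  none      = inj₁ λ a deg>0 → ≰⇒> λ h≤t → none (a , deg>0 , h≤t)

pairs-exceed? : ∀ {n} (t : ℕ) (f g : Fin n → ℕ) →
  (∀ a b → 0 < f a → 0 < g b → t < f a + g b) ⊎ ∃₂ λ a b → 0 < f a × 0 < g b × f a + g b ≤ t
pairs-exceed? t f g with any? (λ a → any? (λ b → 0 <? f a ×-dec 0 <? g b ×-dec f a + g b ≤? t))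
... | yes (a , b , violation) = inj₂ (a , b , violation)
... | no  none                = inj₁ λ a b fa>0 gb>0 → ≰⇒> λ sum≤t → none (a , b , fa>0 , gb>0 , sum≤t)

least-on-support : ∀ {n} (f : Fin n → ℕ) {a} → 0 < f a → ∃ λ b → 0 < f b × ∀ x → 0 < f x → f b ≤ f x
least-on-support f {a} fa>0 = go a fa>0 (<-wellFounded (f a))
  where
  go : ∀ a → 0 < f a → Acc _<_ (f a) → ∃ λ b → 0 < f b × ∀ x → 0 < f x → f b ≤ f x
  go a fa>0 (acc smaller) with any? (λ x → 0 <? f x ×-dec f x <? f a)
  ... | yes (x , fx>0 , fx<fa) = go x fx>0 (smaller fx<fa)
  ... | no  none               = a , fa>0 , λ x fx>0 → ≮⇒≥ λ fx<fa → none (x , fx>0 , fx<fa)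

isMinPseudo-least : ∀ {n} {E : Digraph n} {deg : Fin n → ℕ} {b} → 0 < arcs E → 0 < deg b →
  (∀ x → 0 < deg x → deg b ≤ deg x) → IsMinPseudo E deg (deg b)
isMinPseudo-least {deg = deg} {b} arcs>0 degb>0 least = inj₂ (arcs>0 , bound , maximal)
  where
  bound : PseudoBound deg (deg b)
  bound x with 0 <? deg x
  ... | yes degx>0 = inj₂ (least x degx>0)
  ... | no  degx≯0 = inj₁ (n≤0⇒n≡0 (≮⇒≥ degx≯0))
  maximal : ∀ d → PseudoBound deg d → d ≤ deg b
  maximal d bounded = [ (λ degb≡0 → contradiction (sym degb≡0) (<⇒≢ degb>0)) , id ]′ (bounded b)

minPseudo-on-support : ∀ {n} {E : Digraph n} {deg : Fin n → ℕ} {L : ℕ → Set} {a} →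
  0 < arcs E → 0 < deg a → OnSupport L deg → Σ ℕ λ d → IsMinPseudo E deg d × L d
minPseudo-on-support {deg = deg} arcs>0 dega>0 onSupport with least-on-support deg dega>0
... | b , degb>0 , least = deg b , isMinPseudo-least arcs>0 degb>0 least , onSupport b degb>0

module Peeling {n : ℕ} (A R : ℕ) (2R≤A : 2 * R ≤ A) where

  Q : ℕ
  Q = A ∸ R

  R≤Q : R ≤ Q
  R≤Q = m+n≤o⇒m≤o∸n R (subst (_≤ A) (cong (R +_) (+-identityʳ R)) 2R≤A)

  Q+R≡A : Q + R ≡ A
  Q+R≡A = m∸n+n≡m (≤-trans R≤Q (m∸n≤m A R))

  half≤Q : ∀ {d} → 2 * d ≤ A → d ≤ Q
  half≤Q {d} 2d≤A = *-cancelˡ-≤ 2 (begin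
    2 * d   ≤⟨ 2d≤A ⟩
    A       ≡⟨ Q+R≡A ⟨
    Q + R   ≤⟨ +-monoʳ-≤ Q R≤Q ⟩
    Q + Q   ≡⟨ cong (Q +_) (+-identityʳ Q) ⟨
    2 * Q   ∎)
    where open ≤-Reasoning

  R<half : ∀ {d} → A < 2 * d → R < d
  R<half {d} A<2d = *-cancelˡ-< 2 R d (≤-<-trans 2R≤A A<2d)

  1*-≤ : ∀ {m k} → m ≤ k → 1 * m ≤ k
  1*-≤ {m} = subst (_≤ _) (sym (*-identityˡ m))

  Dense Biased : Digraph n → Set
  Dense  = ArcsExceed A A 2
  Biased = ArcsExceed Q R 1

  OutHeavy InHeavy InAboveR OutAboveQ PairsHeavy : Digraph n → Set
  OutHeavy   E = OnSupport (λ d → A < 2 * d) (outdeg E)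
  InHeavy    E = OnSupport (λ d → A < 2 * d) (indeg E)
  InAboveR   E = OnSupport (R <_) (indeg E)
  OutAboveQ  E = OnSupport (Q <_) (outdeg E)
  PairsHeavy E = ∀ a b → InPlus E a → InMinus E b → A < outdeg E a + indeg E b

  dense-initial : ∀ {D : Digraph n} → A * n < arcs D → Dense D
  dense-initial {D} A*n<arcs = arcs-exceed (begin-strict
    A * plusSize D + A * minusSize D  ≤⟨ +-mono-≤ (*-monoʳ-≤ A (count≤n _)) (*-monoʳ-≤ A (count≤n _)) ⟩
    A * n + A * n                     ≡⟨ cong (A * n +_) (+-identityʳ (A * n)) ⟨
    2 * (A * n)                       <⟨ *-monoʳ-< 2 A*n<arcs ⟩
    2 * arcs D                        ∎)
    where open ≤-Reasoning

  biased-initial : ∀ {D : Digraph n} → A * n < arcs D → Biased D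
  biased-initial {D} A*n<arcs = arcs-exceed (begin-strict
    Q * plusSize D + R * minusSize D  ≤⟨ +-mono-≤ (*-monoʳ-≤ Q (count≤n _)) (*-monoʳ-≤ R (count≤n _)) ⟩
    Q * n + R * n                     ≡⟨ *-distribʳ-+ n Q R ⟨
    (Q + R) * n                       ≡⟨ cong (_* n) Q+R≡A ⟩
    A * n                             <⟨ A*n<arcs ⟩
    arcs D                            ≡⟨ *-identityˡ (arcs D) ⟨
    1 * arcs D                        ∎)
    where open ≤-Reasoning

  dense-of-biased : ∀ {E} → minusSize E ≤ plusSize E → Biased E → Dense E
  dense-of-biased {E} m≤p (arcs-exceed biased) = arcs-exceed (begin-strict
    A * plusSize E + A * minusSize E        ≡⟨ *-distribˡ-+ A (plusSize E) (minusSize E) ⟨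
    A * (plusSize E + minusSize E)          ≡⟨ cong (_* (plusSize E + minusSize E)) Q+R≡A ⟨
    (Q + R) * (plusSize E + minusSize E)    ≤⟨ chebyshev R≤Q m≤p ⟩
    2 * (Q * plusSize E + R * minusSize E)  <⟨ *-monoʳ-< 2 biased ⟩
    2 * (1 * arcs E)                        ≡⟨ cong (2 *_) (*-identityˡ (arcs E)) ⟩
    2 * arcs E                              ∎)
    where open ≤-Reasoning

  dense-deletePair : ∀ {E a b} → 0 < outdeg E a → 0 < indeg E b → outdeg E a + indeg E b ≤ A →
    Dense E → Dense (deletePair a b E)
  dense-deletePair outdeg>0 indeg>0 s≤A =
    ArcsExceed-deletePair outdeg>0 indeg>0 (≤-trans (*-monoʳ-≤ 2 s≤A) (≤-reflexive (cong (A +_) (+-identityʳ A))))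

  Phase1Done : Digraph n → Set
  Phase1Done E = OutHeavy E × InAboveR E × PairsHeavy E × (minusSize E < plusSize E → OutAboveQ E)

  phase1-step : ∀ E → Dense E × Biased E → Phase1Done E ⊎ ∃ λ E′ → E′ ⊏ E × Dense E′ × Biased E′
  phase1-step E (dense , biased)
    with exceeds-on-support? A (2 *_) (outdeg E) | exceeds-on-support? R id (indeg E)
       | pairs-exceed? A (outdeg E) (indeg E)    | minusSize E <? plusSize E
  ... | inj₂ (a , out>0 , 2out≤A) | _ | _ | _ =
    inj₂ (deleteOut a E , deleteOut-⊏ out>0 ,
          ArcsExceed-deleteOut out>0 2out≤A dense , ArcsExceed-deleteOut out>0 (1*-≤ (half≤Q 2out≤A)) biased)
  ... | inj₁ _ | inj₂ (b , in>0 , in≤R) | _ | _ =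
    inj₂ (deleteIn b E , deleteIn-⊏ in>0 ,
          ArcsExceed-deleteIn in>0 (≤-trans (*-monoʳ-≤ 2 in≤R) 2R≤A) dense , ArcsExceed-deleteIn in>0 (1*-≤ in≤R) biased)
  ... | inj₁ _ | inj₁ _ | inj₂ (a , b , out>0 , in>0 , s≤A) | _ =
    inj₂ (deletePair a b E , deletePair-⊏ out>0 ,
          dense-deletePair out>0 in>0 s≤A dense ,
          ArcsExceed-deletePair out>0 in>0 (1*-≤ (subst (_ ≤_) (sym Q+R≡A) s≤A)) biased)
  ... | inj₁ outHeavy | inj₁ inAboveR | inj₁ pairsHeavy | no m≮p =
    inj₁ (outHeavy , inAboveR , pairsHeavy , λ m<p → contradiction m<p m≮p)
  ... | inj₁ outHeavy | inj₁ inAboveR | inj₁ pairsHeavy | yes m<p with exceeds-on-support? Q id (outdeg E)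
  ...   | inj₁ outAboveQ = inj₁ (outHeavy , inAboveR , pairsHeavy , λ _ → outAboveQ)
  ...   | inj₂ (a , out>0 , out≤Q) =
    inj₂ (deleteOut a E , deleteOut-⊏ out>0 , dense-of-biased m′≤p′ biased′ , biased′)
    where
    biased′ : Biased (deleteOut a E)
    biased′ = ArcsExceed-deleteOut out>0 (1*-≤ out≤Q) biased
    m′≤p′ : minusSize (deleteOut a E) ≤ plusSize (deleteOut a E)
    m′≤p′ = s≤s⁻¹ (subst (suc (minusSize (deleteOut a E)) ≤_) (plusSize-deleteOut a E out>0)
                         (≤-<-trans (minusSize-mono (deleteOut-⊑ a E)) m<p))

  Phase2Done : Digraph n → Set
  Phase2Done E = OutHeavy E × InHeavy E × PairsHeavy E

  phase2-step : ∀ E → Dense E → Phase2Done E ⊎ ∃ λ E′ → E′ ⊏ E × Dense E′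
  phase2-step E dense
    with exceeds-on-support? A (2 *_) (outdeg E) | exceeds-on-support? A (2 *_) (indeg E)
       | pairs-exceed? A (outdeg E) (indeg E)
  ... | inj₂ (a , out>0 , 2out≤A) | _ | _ =
    inj₂ (deleteOut a E , deleteOut-⊏ out>0 , ArcsExceed-deleteOut out>0 2out≤A dense)
  ... | inj₁ _ | inj₂ (b , in>0 , 2in≤A) | _ =
    inj₂ (deleteIn b E , deleteIn-⊏ in>0 , ArcsExceed-deleteIn in>0 2in≤A dense)
  ... | inj₁ _ | inj₁ _ | inj₂ (a , b , out>0 , in>0 , s≤A) =
    inj₂ (deletePair a b E , deletePair-⊏ out>0 , dense-deletePair out>0 in>0 s≤A dense)
  ... | inj₁ outHeavy | inj₁ inHeavy | inj₁ pairsHeavy = inj₁ (outHeavy , inHeavy , pairsHeavy)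

  CaseI : Digraph n → Set
  CaseI E = (Σ ℕ λ d → IsMinPseudoOut E d × suc A ≤ 2 * d)
          × (Σ ℕ λ d → IsMinPseudoIn E d × suc R ≤ d)
          × (Σ (Fin n) λ a → suc A ≤ outdeg E a)
          × plusSize E ≤ minusSize E

  CaseII : Digraph n → Digraph n → Set
  CaseII D E = (Σ ℕ λ d → IsMinPseudoSemi E d × suc A ≤ 2 * d)
             × (Σ (Fin n) λ b → suc A ≤ indeg E b)
             × (∀ a → InPlus E a → Q < outdeg D a)

  caseI : ∀ {E} → Dense E → OutHeavy E → InAboveR E → plusSize E ≤ minusSize E → CaseI E
  caseI {E} dense outHeavy inAboveR p≤m =
      minPseudo-on-support arcs>0 (proj₂ (source-exists E arcs>0)) outHeavy
    , minPseudo-on-support arcs>0 (proj₂ (sink-exists E arcs>0)) inAboveR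
    , heavy-source dense p≤m
    , p≤m
    where
    arcs>0 : 0 < arcs E
    arcs>0 = ArcsExceed-arcs>0 dense

  caseII : ∀ {D E} → Dense E → OutHeavy E → InHeavy E → minusSize E ≤ plusSize E →
    (∀ a → InPlus E a → Q < outdeg D a) → CaseII D E
  caseII {E = E} dense outHeavy inHeavy m≤p outAboveQ = semidegree , heavy-sink dense m≤p , outAboveQ
    where
    arcs>0 : 0 < arcs E
    arcs>0 = ArcsExceed-arcs>0 dense
    semidegree : Σ ℕ λ d → IsMinPseudoSemi E d × suc A ≤ 2 * d
    semidegree with minPseudo-on-support arcs>0 (proj₂ (source-exists E arcs>0)) outHeavy
                  | minPseudo-on-support arcs>0 (proj₂ (sink-exists E arcs>0)) inHeavy
    ... | d⁺ , minOut , A<2d⁺ | d⁻ , minIn , A<2d⁻ =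
      d⁺ ⊓ d⁻ , (d⁺ , d⁻ , minOut , minIn , refl) ,
      subst (A <_) (sym (*-distribˡ-⊓ 2 d⁺ d⁻)) (⊓-pres-m< A<2d⁺ A<2d⁻)

  Conclusion : Digraph n → Set
  Conclusion D = Σ (Digraph n) λ D′ → D′ ⊑ D
    × A * (plusSize D′ + minusSize D′) < 2 * arcs D′
    × (∀ a b → InPlus D′ a → InMinus D′ b → suc A ≤ outdeg D′ a + indeg D′ b)
    × (CaseI D′ ⊎ CaseII D D′)

  conclusion : ∀ {D D′} → D′ ⊑ D → Dense D′ → PairsHeavy D′ → CaseI D′ ⊎ CaseII D D′ → Conclusion D
  conclusion {D′ = D′} D′⊑D (arcs-exceed dense) pairsHeavy case =
    D′ , D′⊑D , subst (_< 2 * arcs D′) (sym (*-distribˡ-+ A _ _)) dense , pairsHeavy , case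

  peel : (D : Digraph n) → A * n < arcs D → Conclusion D
  peel D A*n<arcs with descend phase1-step D (dense-initial A*n<arcs , biased-initial A*n<arcs)
  ... | D₁ , D₁⊑D , (dense₁ , _) , (outHeavy₁ , inAboveR₁ , pairsHeavy₁ , outAboveQ₁)
      with plusSize D₁ ≤? minusSize D₁
  ...   | yes p₁≤m₁ = conclusion D₁⊑D dense₁ pairsHeavy₁ (inj₁ (caseI dense₁ outHeavy₁ inAboveR₁ p₁≤m₁))
  ...   | no  p₁≰m₁ with descend phase2-step D₁ dense₁
  ...     | D₂ , D₂⊑D₁ , dense₂ , (outHeavy₂ , inHeavy₂ , pairsHeavy₂) with plusSize D₂ ≤? minusSize D₂
  ...       | yes p₂≤m₂ = conclusion (⊑-trans D₂⊑D₁ D₁⊑D) dense₂ pairsHeavy₂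
                (inj₁ (caseI dense₂ outHeavy₂ (λ b in>0 → R<half (inHeavy₂ b in>0)) p₂≤m₂))
  ...       | no  p₂≰m₂ = conclusion (⊑-trans D₂⊑D₁ D₁⊑D) dense₂ pairsHeavy₂
                (inj₂ (caseII dense₂ outHeavy₂ inHeavy₂ (<⇒≤ (≰⇒> p₂≰m₂)) inherited))
    where
    inherited : ∀ a → InPlus D₂ a → Q < outdeg D a
    inherited a out₂>0 = <-≤-trans (outAboveQ₁ (≰⇒> p₁≰m₁) a (<-≤-trans out₂>0 (outdeg-mono D₂⊑D₁ a)))
                                   (outdeg-mono D₁⊑D a)

lemma5p3 : (k r n : ℕ) → 1 ≤ k → 1 ≤ r → 1 ≤ n →
    2 * r ≤ k + 1 → k ≤ n →
    (D : Digraph n) → Loopless D →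
    (k ∸ 1) * n < arcs D →
    Σ (Digraph n) λ D' → D' ⊑ D
      × (k ∸ 1) * (plusSize D' + minusSize D') < 2 * arcs D'
      × (∀ (a b : Fin n) → InPlus D' a → InMinus D' b → k ≤ outdeg D' a + indeg D' b)
      × ( ( (Σ ℕ λ d → IsMinPseudoOut D' d × k ≤ 2 * d)
          × (Σ ℕ λ d → IsMinPseudoIn D' d × r ≤ d)
          × (Σ (Fin n) λ a → k ≤ outdeg D' a)
          × plusSize D' ≤ minusSize D' )
        ⊎ ( (Σ ℕ λ d → IsMinPseudoSemi D' d × k ≤ 2 * d)
          × (Σ (Fin n) λ b → k ≤ indeg D' b)
          × (∀ (a : Fin n) → InPlus D' a → k ∸ r < outdeg D a) ) )
lemma5p3 (suc A) (suc R) n (s≤s _) (s≤s _) _ 2r≤k+1 _ D _ =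
  Peeling.peel A R (s≤s⁻¹ (s≤s⁻¹ (subst₂ _≤_ (*-suc 2 R) (+-comm (suc A) 1) 2r≤k+1))) D
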